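{- For all integers $a,r,d$ with $a\geq 2$, $r\geq 2$ and $1\leq d <a$, and every positive integer $s$, \[\Sigma_{r, d-1}(a,s)>\Sigma_{r, d}(a,s) \ \text{ if } s\geq (r-1)(d+1)+2,\qquad \Sigma_{r, d-1}(a,s)=\Sigma_{r, d}(a,s)\ \text{ if } s< (r-1)(d+1)+2.\]
   Context: A multigraph is a pair $G=(V,w)$ where $V$ is a finite set and $w:\binom{V}{2}\to\mathbb{Z}_{\geq 0}$; $e(G)=\sum_{xy\in\binom{V}{2}}w(xy)$. For positive integers $a,r$, $d\in\{0,\dots,a-1\}$ and $n$, $\mathcal{T}_{r,d}(a,n)$ is the set of multigraphs $G$ on $[n]=\{1,\dots,n\}$ whose vertex set can be partitioned into $r$ parts $V_0,\dots,V_{r-1}$ such that all pairs inside $V_0$ have multiplicity $a-d$, all pairs inside $V_i$ ($1\le i\le r-1$) have multiplicity $a$, and all other pairs have multiplicity $a+1$. $\Sigma_{r,d}(a,n)=\max\{e(G):G\in\mathcal{T}_{r,d}(a,n)\}$. -}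

module Defs where

open import Data.Nat using (ℕ; zero; suc; _+_; _∸_; _⊔_; _<ᵇ_; _≡ᵇ_)
open import Data.Fin using (Fin; toℕ)
open import Data.Bool using (if_then_else_)
open import Data.List using (List; []; _∷_; map; concatMap; allFin; foldr)
open import Data.Vec.Functional using (Vector) renaming (_∷_ to _∷ᶠ_)

-- A multigraph on [n] (vertices Fin n): multiplicity w x y for the pair {x,y}.
-- Only the values with toℕ x < toℕ y are used (one per unordered pair).
Multigraph : ℕ → Set
Multigraph n = Fin n → Fin n → ℕ

sumFin : (n : ℕ) → (Fin n → ℕ) → ℕ
sumFin n f = foldr _+_ 0 (map f (allFin n))

edges : (n : ℕ) → Multigraph n → ℕ
edges n w = sumFin n λ x → sumFin n λ y →
  if toℕ x <ᵇ toℕ y then w x y else 0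

-- A partition of [n] into r (possibly empty) parts V_0,…,V_{r-1}:
-- the vertex x lies in part V_(f x).
Partition : ℕ → ℕ → Set
Partition n r = Fin n → Fin r

turanGraph : (r d a n : ℕ) → Partition n r → Multigraph n
turanGraph r d a n f x y =
  if toℕ (f x) ≡ᵇ toℕ (f y)
  then (if toℕ (f x) ≡ᵇ 0 then a ∸ d else a)
  else suc a

allPartitions : (n r : ℕ) → List (Partition n r)
allPartitions zero r = (λ ()) ∷ []
allPartitions (suc n) r =
  concatMap (λ c → map (λ g → c ∷ᶠ g) (allPartitions n r)) (allFin r)

-- Σ_{r,d}(a,n) = max { e(G) : G ∈ T_{r,d}(a,n) }
-- (T_{r,d}(a,n) is exactly the set of turanGraph r d a n f over all partitions f.)
Sigma : (r d a n : ℕ) → ℕ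
Sigma r d a n =
  foldr _⊔_ 0 (map (λ f → edges n (turanGraph r d a n f)) (allPartitions n r))

-- Every member of T_{r,c}(a,n) is the complete multigraph with multiplicity a + 1
-- minus a deficit: c + 1 for each pair inside V₀ and 1 for each pair inside another
-- part.  So Σ_{r,c}(a,n) = (a + 1)·C(n,2) − min_f D_c(f), where
-- D_c(f) = (c + 1)·C(|V₀|,2) + Σ_{i≥1} C(|V_i|,2), and D_d = D_{d-1} + C(|V₀|,2).
-- Hence the two maxima agree exactly when some D_{d-1}-optimal partition has |V₀| ≤ 1.
-- Moving a vertex from V_i (i ≥ 1) into V₀ changes D_{d-1} by d·|V₀| − (|V_i| − 1),
-- and moving one from V₀ into V_i changes it by |V_i| − d·(|V₀| − 1).  If
-- s ≥ (r−1)(d+1) + 2 and |V₀| ≤ 1, some other part has more than d + 1 vertices, so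
-- the first move strictly lowers D_{d-1}; if s < (r−1)(d+1) + 2 and |V₀| ≥ 2, some
-- other part has at most d vertices, so the second move does not raise D_{d-1}.
module Submission where

open import Defs
open import Data.Nat.Properties
open import Algebra.Properties.Semiring.Sum +-*-semiring
  using (sum-syntax; sum-cong-≗; sum-replicate-zero; ∑-distrib-+; ∑-comm; *-distribˡ-sum)
open import Algebra.Properties.CommutativeSemigroup +-commutativeSemigroup
  using (x∙yz≈y∙xz)
open import Algebra.Properties.CommutativeSemigroup *-commutativeSemigroup
  using () renaming (x∙yz≈y∙xz to x*[y*z]≡y*[x*z])
open import Data.Bool using (true; false; if_then_else_; T)
open import Data.Fin using (Fin; zero; suc; toℕ)
open import Data.Fin.Properties using (toℕ-injective; ¬∀⟶∃¬)
open import Data.List using (foldr; tabulate)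
open import Data.List.Properties using (map-tabulate; foldr-preservesᵇ; foldr-preservesᵒ)
open import Data.List.Membership.Propositional.Properties using (∈-allFin)
open import Data.List.Relation.Unary.Any as Any using (Any; here)
import Data.List.Relation.Unary.Any.Properties as Anyₚ
import Data.List.Relation.Unary.All as All
import Data.List.Relation.Unary.All.Properties as Allₚ
open import Data.Nat using (ℕ; zero; suc; _+_; _*_; _∸_; _≤_; _<_; _≥_; _>_; _⊔_; _<ᵇ_; _≡ᵇ_; _≤?_; z≤n; s≤s)
open import Data.Nat.Combinatorics using (_C_; nC1≡n; nCk+nC[k+1]≡[n+1]C[k+1])
open import Data.Product using (_×_; _,_; ∃; map₂) renaming (map to mapΣ)
open import Data.Sum using (inj₁; inj₂)
open import Data.Vec.Functional using (updateAt)
open import Function using (_∘_; id)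
open import Relation.Binary.PropositionalEquality
open import Relation.Nullary using (Dec; yes; no)

∑-const : ∀ n b → ∑[ i < n ] b ≡ n * b
∑-const zero b = refl
∑-const (suc n) b = cong (b +_) (∑-const n b)

∑-mono-≤ : ∀ {n} {f g : Fin n → ℕ} → (∀ i → f i ≤ g i) → ∑[ i < n ] f i ≤ ∑[ i < n ] g i
∑-mono-≤ {zero} _ = z≤n
∑-mono-≤ {suc n} f≤g = +-mono-≤ (f≤g zero) (∑-mono-≤ (f≤g ∘ suc))

∃-above-average : ∀ n (m : Fin n → ℕ) b → n * b < ∑[ i < n ] m i → ∃ λ i → b < m i
∃-above-average n m b avg<∑ = map₂ ≰⇒> (¬∀⟶∃¬ n (λ i → m i ≤ b) (λ i → m i ≤? b)
  λ all≤ → <⇒≱ avg<∑ (≤-trans (∑-mono-≤ all≤) (≤-reflexive (∑-const n b))))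

∃-below-average : ∀ n (m : Fin n → ℕ) b → ∑[ i < n ] m i < n * b → ∃ λ i → m i < b
∃-below-average n m b ∑<avg = map₂ ≰⇒> (¬∀⟶∃¬ n (λ i → b ≤ m i) (λ i → b ≤? m i)
  λ all≥ → <⇒≱ ∑<avg (≤-trans (≤-reflexive (sym (∑-const n b))) (∑-mono-≤ all≥)))

foldr-+-tabulate : ∀ n (g : Fin n → ℕ) → foldr _+_ 0 (tabulate g) ≡ ∑[ i < n ] g i
foldr-+-tabulate zero g = refl
foldr-+-tabulate (suc n) g = cong (g zero +_) (foldr-+-tabulate n (g ∘ suc))

sumFin≡∑ : ∀ n (f : Fin n → ℕ) → sumFin n f ≡ ∑[ i < n ] f i
sumFin≡∑ n f = trans (cong (foldr _+_ 0) (map-tabulate id f)) (foldr-+-tabulate n f)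

m+n≡o+p⇒o≤m⇒n≤p : ∀ {m n o p} → m + n ≡ o + p → o ≤ m → n ≤ p
m+n≡o+p⇒o≤m⇒n≤p {m} {n} {o} {p} eq o≤m =
  +-cancelˡ-≤ o n p (≤-trans (+-monoˡ-≤ n o≤m) (≤-reflexive eq))

m+n≡o+p⇒o<m⇒n<p : ∀ {m n o p} → m + n ≡ o + p → o < m → n < p
m+n≡o+p⇒o<m⇒n<p {m} {n} {o} {p} eq o<m =
  +-cancelˡ-< o n p (≤-trans (+-monoˡ-< n o<m) (≤-reflexive eq))

suc-C2 : ∀ m → suc m C 2 ≡ m + m C 2
suc-C2 m = trans (sym (nCk+nC[k+1]≡[n+1]C[k+1] m 1)) (cong (_+ m C 2) (nC1≡n m))

C2≡0 : ∀ {m} → m ≤ 1 → m C 2 ≡ 0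
C2≡0 {zero} _ = refl
C2≡0 {suc zero} _ = refl
C2≡0 {suc (suc _)} (s≤s ())

C2-pos : ∀ {m} → 2 ≤ m → 0 < m C 2
C2-pos {suc zero} (s≤s ())
C2-pos {suc (suc k)} _ = ≤-trans (s≤s z≤n) (≤-trans (m≤m+n (suc k) _) (≤-reflexive (sym (suc-C2 (suc k)))))

δ : ∀ {n} → Fin n → Fin n → ℕ
δ i j = if toℕ i ≡ᵇ toℕ j then 1 else 0

δ-refl : ∀ {n} (i : Fin n) → δ i i ≡ 1
δ-refl zero = refl
δ-refl (suc i) = δ-refl i

∑-δ : ∀ {n} (j : Fin n) (h : Fin n → ℕ) → ∑[ i < n ] (δ i j * h i) ≡ h j
∑-δ {suc n} zero h =
  trans (cong (1 * h zero +_) (sum-replicate-zero n)) (trans (+-identityʳ _) (*-identityˡ (h zero)))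
∑-δ {suc n} (suc j) h = ∑-δ j (h ∘ suc)

if-then-0≡*δ : ∀ {n} (i j : Fin n) w → (if toℕ i ≡ᵇ toℕ j then w else 0) ≡ w * δ i j
if-then-0≡*δ i j w with toℕ i ≡ᵇ toℕ j
... | true = sym (*-identityʳ w)
... | false = sym (*-zeroʳ w)

δ+-C2 : ∀ {n} (i j : Fin n) m → (δ i j + m) C 2 ≡ m C 2 + δ i j * m
δ+-C2 i j m with toℕ i ≡ᵇ toℕ j
... | true = trans (suc-C2 m) (trans (+-comm m _) (cong (m C 2 +_) (sym (*-identityˡ m))))
... | false = sym (+-identityʳ _)

blockSize : ∀ {n r} → Partition n r → Fin r → ℕ
blockSize {n} f i = ∑[ x < n ] δ i (f x)

blockSize-sum : ∀ {n r} (f : Partition n r) → ∑[ i < r ] blockSize f i ≡ n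
blockSize-sum {n} {r} f = begin
  ∑[ i < r ] ∑[ x < n ] δ i (f x)   ≡⟨ ∑-comm (λ i x → δ i (f x)) ⟩
  ∑[ x < n ] ∑[ i < r ] δ i (f x)   ≡⟨ sum-cong-≗ (λ x → one-block (f x)) ⟩
  ∑[ x < n ] 1                      ≡⟨ trans (∑-const n 1) (*-identityʳ n) ⟩
  n                                 ∎
  where
  open ≡-Reasoning
  one-block : ∀ j → ∑[ i < r ] δ i j ≡ 1
  one-block j = trans (sum-cong-≗ (λ i → sym (*-identityʳ (δ i j)))) (∑-δ j (λ _ → 1))

blockSize-pos⇒nonempty : ∀ {n r} (f : Partition n r) i → 0 < blockSize f i → ∃ λ v → f v ≡ i
blockSize-pos⇒nonempty {suc n} f i pos with toℕ i ≡ᵇ toℕ (f zero) in i≡f₀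
... | true = zero , sym (toℕ-injective (≡ᵇ⇒≡ (toℕ i) (toℕ (f zero)) (subst T (sym i≡f₀) _)))
... | false = mapΣ suc id (blockSize-pos⇒nonempty (f ∘ suc) i pos)

blockSize-updateAt : ∀ {n r} (f : Partition n r) v q i →
  δ i (f v) + blockSize (updateAt f v (λ _ → q)) i ≡ δ i q + blockSize f i
blockSize-updateAt {suc n} f zero q i = x∙yz≈y∙xz (δ i (f zero)) (δ i q) _
blockSize-updateAt {suc n} f (suc v) q i = begin
  δ i (f (suc v)) + (δ i (f zero) + blockSize (updateAt (f ∘ suc) v (λ _ → q)) i)
    ≡⟨ x∙yz≈y∙xz (δ i (f (suc v))) (δ i (f zero)) _ ⟩
  δ i (f zero) + (δ i (f (suc v)) + blockSize (updateAt (f ∘ suc) v (λ _ → q)) i)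
    ≡⟨ cong (δ i (f zero) +_) (blockSize-updateAt (f ∘ suc) v q i) ⟩
  δ i (f zero) + (δ i q + blockSize (f ∘ suc) i)
    ≡⟨ x∙yz≈y∙xz (δ i (f zero)) (δ i q) _ ⟩
  δ i q + blockSize f i ∎
  where open ≡-Reasoning

-- a + 1 minus the multiplicity of a pair inside V_i, when c ≤ a.
deficit : ∀ {r} → ℕ → Fin r → ℕ
deficit c zero = suc c
deficit c (suc _) = 1

pairDeficit : ∀ {n r} → ℕ → Partition n r → Fin n → Fin n → ℕ
pairDeficit c f x y = if toℕ (f x) ≡ᵇ toℕ (f y) then deficit c (f x) else 0

totalDeficit : ∀ {r} → ℕ → (Fin r → ℕ) → ℕ
totalDeficit {r} c m = ∑[ i < r ] (deficit c i * (m i C 2))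

totalDeficit-cong : ∀ {r} c {m m′ : Fin r → ℕ} → (∀ i → m i ≡ m′ i) →
  totalDeficit c m ≡ totalDeficit c m′
totalDeficit-cong c m≗m′ = sum-cong-≗ (λ i → cong (λ k → deficit c i * (k C 2)) (m≗m′ i))

totalDeficit-suc : ∀ {r} c (m : Fin (suc r) → ℕ) → totalDeficit (suc c) m ≡ m zero C 2 + totalDeficit c m
totalDeficit-suc c m = +-assoc (m zero C 2) (suc c * (m zero C 2)) _

totalDeficit-mono : ∀ {r} c (m : Fin (suc r) → ℕ) → totalDeficit c m ≤ totalDeficit (suc c) m
totalDeficit-mono c m = ≤-trans (m≤n+m _ (m zero C 2)) (≤-reflexive (sym (totalDeficit-suc c m)))

totalDeficit-addVertex : ∀ {r} c j (m : Fin r → ℕ) →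
  totalDeficit c (λ i → δ i j + m i) ≡ deficit c j * m j + totalDeficit c m
totalDeficit-addVertex {r} c j m = begin
  ∑[ i < r ] (deficit c i * ((δ i j + m i) C 2))
    ≡⟨ sum-cong-≗ expand ⟩
  ∑[ i < r ] (deficit c i * (m i C 2) + δ i j * (deficit c i * m i))
    ≡⟨ ∑-distrib-+ (λ i → deficit c i * (m i C 2)) (λ i → δ i j * (deficit c i * m i)) ⟩
  totalDeficit c m + ∑[ i < r ] (δ i j * (deficit c i * m i))
    ≡⟨ cong (totalDeficit c m +_) (∑-δ j (λ i → deficit c i * m i)) ⟩
  totalDeficit c m + deficit c j * m j
    ≡⟨ +-comm (totalDeficit c m) _ ⟩
  deficit c j * m j + totalDeficit c m ∎
  where
  open ≡-Reasoning
  expand : ∀ i → deficit c i * ((δ i j + m i) C 2) ≡ deficit c i * (m i C 2) + δ i j * (deficit c i * m i)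
  expand i = trans (cong (deficit c i *_) (δ+-C2 i j (m i)))
    (trans (*-distribˡ-+ (deficit c i) _ _)
           (cong (deficit c i * (m i C 2) +_) (x*[y*z]≡y*[x*z] (deficit c i) (δ i j) (m i))))

totalDeficit-updateAt : ∀ {n r} c (f : Partition n r) v q →
  let g = updateAt f v (λ _ → q) in
  deficit c (f v) * blockSize g (f v) + totalDeficit c (blockSize g)
    ≡ deficit c q * blockSize f q + totalDeficit c (blockSize f)
totalDeficit-updateAt c f v q = begin
  deficit c (f v) * blockSize g (f v) + totalDeficit c (blockSize g)
    ≡⟨ totalDeficit-addVertex c (f v) (blockSize g) ⟨
  totalDeficit c (λ i → δ i (f v) + blockSize g i)
    ≡⟨ totalDeficit-cong c (blockSize-updateAt f v q) ⟩
  totalDeficit c (λ i → δ i q + blockSize f i)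
    ≡⟨ totalDeficit-addVertex c q (blockSize f) ⟩
  deficit c q * blockSize f q + totalDeficit c (blockSize f) ∎
  where
  open ≡-Reasoning
  g = updateAt f v (λ _ → q)

edges-∑ : ∀ n (w : Multigraph n) →
  edges n w ≡ ∑[ x < n ] ∑[ y < n ] (if toℕ x <ᵇ toℕ y then w x y else 0)
edges-∑ n w = trans (sumFin≡∑ n _)
  (sum-cong-≗ (λ x → sumFin≡∑ n (λ y → if toℕ x <ᵇ toℕ y then w x y else 0)))

edges-suc : ∀ n (w : Multigraph (suc n)) →
  edges (suc n) w ≡ ∑[ y < n ] w zero (suc y) + edges n (λ x y → w (suc x) (suc y))
edges-suc n w = trans (edges-∑ (suc n) w) (cong (∑[ y < n ] w zero (suc y) +_) (sym (edges-∑ n _)))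

edges-cong : ∀ n {w w′ : Multigraph n} → (∀ x y → w x y ≡ w′ x y) → edges n w ≡ edges n w′
edges-cong n {w} {w′} w≗w′ = trans (edges-∑ n w) (trans
  (sum-cong-≗ (λ x → sum-cong-≗ (λ y → cong (if toℕ x <ᵇ toℕ y then_else 0) (w≗w′ x y))))
  (sym (edges-∑ n w′)))

edges-+ : ∀ n {w w′ w″ : Multigraph n} → (∀ x y → w x y + w′ x y ≡ w″ x y) →
  edges n w + edges n w′ ≡ edges n w″
edges-+ zero _ = refl
edges-+ (suc n) {w} {w′} {w″} sum≡ = begin
  edges (suc n) w + edges (suc n) w′
    ≡⟨ cong₂ _+_ (edges-suc n w) (edges-suc n w′) ⟩
  (R w + E w) + (R w′ + E w′)
    ≡⟨ +-assoc (R w) (E w) _ ⟩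
  R w + (E w + (R w′ + E w′))
    ≡⟨ cong (R w +_) (x∙yz≈y∙xz (E w) (R w′) (E w′)) ⟩
  R w + (R w′ + (E w + E w′))
    ≡⟨ +-assoc (R w) (R w′) _ ⟨
  (R w + R w′) + (E w + E w′)
    ≡⟨ cong₂ _+_ (trans (sym (∑-distrib-+ (λ y → w zero (suc y)) (λ y → w′ zero (suc y))))
                         (sum-cong-≗ (λ y → sum≡ zero (suc y))))
                 (edges-+ n (λ x y → sum≡ (suc x) (suc y))) ⟩
  R w″ + E w″
    ≡⟨ edges-suc n w″ ⟨
  edges (suc n) w″ ∎
  where
  open ≡-Reasoning
  R E : Multigraph (suc n) → ℕ
  R u = ∑[ y < n ] u zero (suc y)
  E u = edges n (λ x y → u (suc x) (suc y))

edges-pairDeficit : ∀ {r} c n (f : Partition n r) → edges n (pairDeficit c f) ≡ totalDeficit c (blockSize f)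
edges-pairDeficit {r} c zero f =
  sym (trans (sum-cong-≗ {r} {λ i → deficit c i * 0} (λ i → *-zeroʳ (deficit c i))) (sum-replicate-zero r))
edges-pairDeficit c (suc n) f = begin
  edges (suc n) (pairDeficit c f)
    ≡⟨ edges-suc n (pairDeficit c f) ⟩
  ∑[ y < n ] pairDeficit c f zero (suc y) + edges n (pairDeficit c (f ∘ suc))
    ≡⟨ cong₂ _+_ firstRow (edges-pairDeficit c n (f ∘ suc)) ⟩
  deficit c (f zero) * blockSize (f ∘ suc) (f zero) + totalDeficit c (blockSize (f ∘ suc))
    ≡⟨ totalDeficit-addVertex c (f zero) (blockSize (f ∘ suc)) ⟨
  totalDeficit c (blockSize f) ∎
  where
  open ≡-Reasoning
  firstRow : ∑[ y < n ] pairDeficit c f zero (suc y) ≡ deficit c (f zero) * blockSize (f ∘ suc) (f zero)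
  firstRow = trans (sum-cong-≗ (λ y → if-then-0≡*δ (f zero) (f (suc y)) (deficit c (f zero))))
                   (sym (*-distribˡ-sum (deficit c (f zero)) (λ y → δ (f zero) (f (suc y)))))

deficit+multiplicity : ∀ {r} {c a} (i : Fin r) → c ≤ a →
  deficit c i + (if toℕ i ≡ᵇ 0 then a ∸ c else a) ≡ suc a
deficit+multiplicity zero c≤a = cong suc (m+[n∸m]≡n c≤a)
deficit+multiplicity (suc i) _ = refl

totalDeficit+edges : ∀ r c a n (f : Partition n r) → c ≤ a →
  totalDeficit c (blockSize f) + edges n (turanGraph r c a n f) ≡ edges n (λ _ _ → suc a)
totalDeficit+edges r c a n f c≤a =
  trans (cong (_+ edges n (turanGraph r c a n f)) (sym (edges-pairDeficit c n f))) (edges-+ n pairwise)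
  where
  pairwise : ∀ x y → pairDeficit c f x y + turanGraph r c a n f x y ≡ suc a
  pairwise x y with toℕ (f x) ≡ᵇ toℕ (f y)
  ... | true = deficit+multiplicity (f x) c≤a
  ... | false = refl

module _ {r a n : ℕ} {c c′ : ℕ} (c≤a : c ≤ a) (c′≤a : c′ ≤ a) (f g : Partition n r) where

  edges-≤-by-deficit : totalDeficit c′ (blockSize g) ≤ totalDeficit c (blockSize f) →
    edges n (turanGraph r c a n f) ≤ edges n (turanGraph r c′ a n g)
  edges-≤-by-deficit = m+n≡o+p⇒o≤m⇒n≤p
    (trans (totalDeficit+edges r c a n f c≤a) (sym (totalDeficit+edges r c′ a n g c′≤a)))

  edges-<-by-deficit : totalDeficit c′ (blockSize g) < totalDeficit c (blockSize f) →
    edges n (turanGraph r c a n f) < edges n (turanGraph r c′ a n g)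
  edges-<-by-deficit = m+n≡o+p⇒o<m⇒n<p
    (trans (totalDeficit+edges r c a n f c≤a) (sym (totalDeficit+edges r c′ a n g c′≤a)))

allPartitions-complete : ∀ n r (f : Partition n r) → Any (λ g → ∀ x → f x ≡ g x) (allPartitions n r)
allPartitions-complete zero r f = here (λ ())
allPartitions-complete (suc n) r f = Anyₚ.concatMap⁺ _ (Any.map (λ { refl →
  Anyₚ.map⁺ (Any.map (λ tail≗ → λ { zero → refl ; (suc x) → tail≗ x })
                     (allPartitions-complete n r (f ∘ suc))) }) (∈-allFin (f zero)))

turanGraph-cong : ∀ r c a n {f g : Partition n r} → (∀ x → f x ≡ g x) →
  ∀ x y → turanGraph r c a n f x y ≡ turanGraph r c a n g x y
turanGraph-cong r c a n f≗g x y =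
  cong₂ (λ i j → if toℕ i ≡ᵇ toℕ j then (if toℕ i ≡ᵇ 0 then a ∸ c else a) else suc a) (f≗g x) (f≗g y)

edges≤Sigma : ∀ r c a n (f : Partition n r) → edges n (turanGraph r c a n f) ≤ Sigma r c a n
edges≤Sigma r c a n f = foldr-preservesᵒ {P = edges n (turanGraph r c a n f) ≤_} {f = _⊔_}
  (λ { x y (inj₁ p) → ≤-trans p (m≤m⊔n x y) ; x y (inj₂ p) → ≤-trans p (m≤n⊔m x y) }) 0 _
  (inj₂ (Anyₚ.map⁺ (Any.map (λ f≗g → ≤-reflexive (edges-cong n (turanGraph-cong r c a n f≗g)))
                            (allPartitions-complete n r f))))

Sigma-preserves : ∀ r c a n (P : ℕ → Set) → (∀ {x y} → P x → P y → P (x ⊔ y)) → P 0 →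
  (∀ f → P (edges n (turanGraph r c a n f))) → P (Sigma r c a n)
Sigma-preserves r c a n P pres P0 Pf =
  foldr-preservesᵇ {P = P} {f = _⊔_} pres P0 (Allₚ.map⁺ (All.universal Pf (allPartitions n r)))

module _ {r′ s : ℕ} (d′ : ℕ) where

  Part = Partition s (suc r′)

  moveInto-V₀-cheaper : ∀ (g : Part) v i → g v ≡ suc i → blockSize g zero ≤ 1 →
    suc (suc d′) < blockSize g (suc i) →
    totalDeficit d′ (blockSize (updateAt g v (λ _ → zero))) < totalDeficit d′ (blockSize g)
  moveInto-V₀-cheaper g v i gv≡ n₀≤1 big = m+n≡o+p⇒o<m⇒n<p balance
    (≤-trans (s≤s (≤-trans (*-monoʳ-≤ (suc d′) n₀≤1) (≤-reflexive (*-identityʳ (suc d′)))))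
             (≤-pred (≤-trans big (≤-reflexive (sym left)))))
    where
    f = updateAt g v (λ _ → zero)
    balance : blockSize f (suc i) + totalDeficit d′ (blockSize f)
                ≡ suc d′ * blockSize g zero + totalDeficit d′ (blockSize g)
    balance = trans (cong (_+ totalDeficit d′ (blockSize f)) (sym (*-identityˡ (blockSize f (suc i))))) (subst
      (λ p → deficit d′ p * blockSize f p + totalDeficit d′ (blockSize f)
               ≡ suc d′ * blockSize g zero + totalDeficit d′ (blockSize g))
      gv≡ (totalDeficit-updateAt d′ g v zero))
    left : suc (blockSize f (suc i)) ≡ blockSize g (suc i)
    left = trans (cong (_+ blockSize f (suc i)) (sym (δ-refl (suc i))))
      (subst (λ p → δ (suc i) p + blockSize f (suc i) ≡ blockSize g (suc i)) gv≡
             (blockSize-updateAt g v zero (suc i)))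

  moveOutOf-V₀-cheaper : ∀ (f : Part) v i → f v ≡ zero → 2 ≤ blockSize f zero →
    blockSize f (suc i) ≤ suc d′ →
    let g = updateAt f v (λ _ → suc i) in
    suc (blockSize g zero) ≡ blockSize f zero × totalDeficit d′ (blockSize g) ≤ totalDeficit d′ (blockSize f)
  moveOutOf-V₀-cheaper f v i fv≡ 2≤n₀ small = left , m+n≡o+p⇒o≤m⇒n≤p balance
    (≤-trans small (≤-trans (≤-reflexive (sym (*-identityʳ (suc d′)))) (*-monoʳ-≤ (suc d′) g₀≥1)))
    where
    g = updateAt f v (λ _ → suc i)
    left : suc (blockSize g zero) ≡ blockSize f zero
    left = subst (λ p → δ zero p + blockSize g zero ≡ blockSize f zero) fv≡
                 (blockSize-updateAt f v (suc i) zero)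
    g₀≥1 : 1 ≤ blockSize g zero
    g₀≥1 = ≤-pred (≤-trans 2≤n₀ (≤-reflexive (sym left)))
    balance : suc d′ * blockSize g zero + totalDeficit d′ (blockSize g)
                ≡ blockSize f (suc i) + totalDeficit d′ (blockSize f)
    balance = trans (subst
      (λ p → deficit d′ p * blockSize g p + totalDeficit d′ (blockSize g)
               ≡ 1 * blockSize f (suc i) + totalDeficit d′ (blockSize f))
      fv≡ (totalDeficit-updateAt d′ f v (suc i)))
      (cong (_+ totalDeficit d′ (blockSize f)) (*-identityˡ (blockSize f (suc i))))

  outside-V₀-large : ∀ {P} → P + 2 ≤ s → (g : Part) → blockSize g zero ≤ 1 →
    P < ∑[ i < r′ ] blockSize g (suc i)
  outside-V₀-large {P} hs g n₀≤1 = ≤-pred (≤-trans (≤-reflexive (+-comm 2 P)) (≤-trans hs (≤-trans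
    (≤-reflexive (sym (blockSize-sum g))) (+-monoˡ-≤ _ n₀≤1))))

  outside-V₀-small : ∀ {P} → s < P + 2 → (f : Part) → 2 ≤ blockSize f zero →
    ∑[ i < r′ ] blockSize f (suc i) < P
  outside-V₀-small {P} hs f 2≤n₀ = ≤-pred (≤-pred (≤-trans
    (s≤s (≤-trans (+-monoˡ-≤ _ 2≤n₀) (≤-reflexive (blockSize-sum f))))
    (≤-trans hs (≤-reflexive (+-comm P 2)))))

  cheaper-than-d : r′ * (suc d′ + 1) + 2 ≤ s → ∀ (g : Part) →
    ∃ λ f → totalDeficit d′ (blockSize f) < totalDeficit (suc d′) (blockSize g)
  cheaper-than-d hs g with blockSize g zero ≤? 1
  ... | no n₀≰1 = g ,
    <-≤-trans (m<n+m _ (C2-pos (≰⇒> n₀≰1))) (≤-reflexive (sym (totalDeficit-suc d′ (blockSize g))))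
  ... | yes n₀≤1 with ∃-above-average r′ (blockSize g ∘ suc) (suc d′ + 1) (outside-V₀-large hs g n₀≤1)
  ...   | i , big with blockSize-pos⇒nonempty g (suc i) (≤-trans (s≤s z≤n) big)
  ...     | v , gv≡ = updateAt g v (λ _ → zero) ,
    <-≤-trans (moveInto-V₀-cheaper g v i gv≡ n₀≤1 (subst (_< blockSize g (suc i)) (+-comm (suc d′) 1) big))
              (totalDeficit-mono d′ (blockSize g))

  shrink-V₀ : s < r′ * (suc d′ + 1) + 2 → ∀ (f : Part) → 2 ≤ blockSize f zero →
    ∃ λ g → suc (blockSize g zero) ≡ blockSize f zero
          × totalDeficit d′ (blockSize g) ≤ totalDeficit d′ (blockSize f)
  shrink-V₀ hs f 2≤n₀
    with ∃-below-average r′ (blockSize f ∘ suc) (suc d′ + 1) (outside-V₀-small hs f 2≤n₀)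
  ... | i , small with blockSize-pos⇒nonempty f zero (≤-trans (s≤s z≤n) 2≤n₀)
  ...   | v , fv≡ = updateAt f v (λ _ → suc i) ,
    moveOutOf-V₀-cheaper f v i fv≡ 2≤n₀ (≤-pred (subst (blockSize f (suc i) <_) (+-comm (suc d′) 1) small))

  cheapest-with-small-V₀ : s < r′ * (suc d′ + 1) + 2 → ∀ k (f : Part) → blockSize f zero ≤ k →
    ∃ λ g → blockSize g zero ≤ 1 × totalDeficit d′ (blockSize g) ≤ totalDeficit d′ (blockSize f)
  cheapest-with-small-V₀ hs zero f n₀≤0 = f , ≤-trans n₀≤0 z≤n , ≤-refl
  cheapest-with-small-V₀ hs (suc k) f n₀≤k+1 = byV₀ (blockSize f zero ≤? 1)
    where
    byV₀ : Dec (blockSize f zero ≤ 1) →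
      ∃ λ g → blockSize g zero ≤ 1 × totalDeficit d′ (blockSize g) ≤ totalDeficit d′ (blockSize f)
    byV₀ (yes n₀≤1) = f , n₀≤1 , ≤-refl
    byV₀ (no n₀≰1) =
      let g , shrunk , g≤f = shrink-V₀ hs f (≰⇒> n₀≰1)
          h , h₀≤1 , h≤g = cheapest-with-small-V₀ hs k g (≤-pred (≤-trans (≤-reflexive shrunk) n₀≤k+1))
      in h , h₀≤1 , ≤-trans h≤g g≤f

module _ {r′ a s : ℕ} (d′ : ℕ) (d≤a : suc d′ ≤ a) where

  d′≤a : d′ ≤ a
  d′≤a = ≤-trans (n≤1+n d′) d≤a

  Sigma-strict : r′ * (suc d′ + 1) + 2 ≤ s → Sigma (suc r′) (suc d′) a s < Sigma (suc r′) d′ a s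
  Sigma-strict hs = Sigma-preserves (suc r′) (suc d′) a s (_< Sigma (suc r′) d′ a s) ⊔-lub
    (≤-<-trans z≤n (beaten (λ _ → zero))) beaten
    where
    beaten : ∀ g → edges s (turanGraph (suc r′) (suc d′) a s g) < Sigma (suc r′) d′ a s
    beaten g = let f , cheaper = cheaper-than-d d′ hs g in
      <-≤-trans (edges-<-by-deficit d≤a d′≤a g f cheaper) (edges≤Sigma (suc r′) d′ a s f)

  Sigma-equal : s < r′ * (suc d′ + 1) + 2 → Sigma (suc r′) d′ a s ≡ Sigma (suc r′) (suc d′) a s
  Sigma-equal hs = ≤-antisym
    (Sigma-preserves (suc r′) d′ a s (_≤ Sigma (suc r′) (suc d′) a s) ⊔-lub z≤n matched)
    (Sigma-preserves (suc r′) (suc d′) a s (_≤ Sigma (suc r′) d′ a s) ⊔-lub z≤n λ f →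
      ≤-trans (edges-≤-by-deficit d≤a d′≤a f f (totalDeficit-mono d′ (blockSize f)))
              (edges≤Sigma (suc r′) d′ a s f))
    where
    matched : ∀ f → edges s (turanGraph (suc r′) d′ a s f) ≤ Sigma (suc r′) (suc d′) a s
    matched f =
      let g , g₀≤1 , cheaper = cheapest-with-small-V₀ d′ hs (blockSize f zero) f ≤-refl
          V₀-free : totalDeficit (suc d′) (blockSize g) ≡ totalDeficit d′ (blockSize g)
          V₀-free = trans (totalDeficit-suc d′ (blockSize g))
                          (cong (_+ totalDeficit d′ (blockSize g)) (C2≡0 g₀≤1))
      in ≤-trans (edges-≤-by-deficit d′≤a d≤a f g (≤-trans (≤-reflexive V₀-free) cheaper))
                 (edges≤Sigma (suc r′) (suc d′) a s g)

corollary5p2 : (a r d s : ℕ) → a ≥ 2 → r ≥ 2 → 1 ≤ d → d < a → 1 ≤ s →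
    (s ≥ (r ∸ 1) * (d + 1) + 2 → Sigma r (d ∸ 1) a s > Sigma r d a s)
    × (s < (r ∸ 1) * (d + 1) + 2 → Sigma r (d ∸ 1) a s ≡ Sigma r d a s)
corollary5p2 a (suc r′) (suc d′) s _ _ _ d<a _ =
  Sigma-strict d′ (<⇒≤ d<a) , Sigma-equal d′ (<⇒≤ d<a)
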